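{- Let $\Gamma_1,\Gamma_2$ be finite connected simple graphs whose normalized Laplacians have a common eigenvalue $\lambda$, with eigenfunctions $f^1_\lambda$ on $\Gamma_1$ and $f^2_\lambda$ on $\Gamma_2$. Assume $f^1_\lambda(p_1)=0$ and $f^2_\lambda(p_2)=0$ for some vertices $p_1\in\Gamma_1$, $p_2\in\Gamma_2$. Let $\Gamma$ be the graph obtained from the disjoint union of $\Gamma_1$ and $\Gamma_2$ by identifying $p_1$ with $p_2$. Then $\lambda$ is an eigenvalue of the normalized Laplacian of $\Gamma$, with an eigenfunction equal to $f^1_\lambda$ on $\Gamma_1$ and to $f^2_\lambda$ on $\Gamma_2$.
   Context: For a finite graph without isolated vertices, with degrees $n_i$, the normalized Laplacian is $\Delta v(i)=v(i)-\frac{1}{n_i}\sum_{j\sim i}v(j)$ on real functions on the vertices ($j\sim i$ means adjacent); an eigenfunction for $\lambda$ is a nonzero $u$ with $\Delta u=\lambda u$. -}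

module Defs where

open import Level using (Level; suc; _⊔_)
open import Data.Nat as ℕ using (ℕ; zero)
open import Data.Bool using (Bool; true; false; if_then_else_; _∧_)
open import Data.Fin using (Fin; punchIn; punchOut; _↑ˡ_; _↑ʳ_; splitAt; _≟_)
open import Data.Sum using (inj₁; inj₂)
open import Relation.Nullary using (¬_; yes; no)
open import Relation.Nullary.Decidable using (⌊_⌋)
open import Relation.Binary.PropositionalEquality using (_≡_)
open import Algebra.Bundles using (CommutativeRing)

record Graph (n : ℕ) : Set where
  field
    adj    : Fin n → Fin n → Bool
    sym    : ∀ i j → adj i j ≡ adj j i
    irrefl : ∀ i → adj i i ≡ false
open Graph public

data Reach {n : ℕ} (G : Graph n) : Fin n → Fin n → Set where
  here : ∀ {i} → Reach G i i
  step : ∀ {i j k} → adj G i j ≡ true → Reach G j k → Reach G i k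

Connected : ∀ {n} → Graph n → Set
Connected G = ∀ i j → Reach G i j

count : ∀ {n} → (Fin n → Bool) → ℕ
count {zero}    p = zero
count {ℕ.suc n} p = (if p Data.Fin.zero then 1 else 0) ℕ.+ count (λ j → p (Data.Fin.suc j))

Adj : ℕ → Set
Adj n = Fin n → Fin n → Bool

degree : ∀ {n} → Adj n → Fin n → ℕ
degree a i = count (a i)

NoIsolated : ∀ {n} → Graph n → Set
NoIsolated G = ∀ i → ¬ (degree (adj G) i ≡ zero)

-- Scalars: a commutative ring in which every positive integer has a
-- (chosen) inverse, i.e. a ℚ-algebra (the reals are the intended case).

module _ {c ℓ : Level} (R : CommutativeRing c ℓ) where
  open CommutativeRing R
  natR : ℕ → Carrier
  natR zero      = 0#
  natR (ℕ.suc k) = 1# + natR k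

record QAlgebra (c ℓ : Level) : Set (suc (c ⊔ ℓ)) where
  field
    scalars    : CommutativeRing c ℓ
  open CommutativeRing scalars
  field
    inv     : ℕ → Carrier
    inv-suc : ∀ k → natR scalars (ℕ.suc k) * inv (ℕ.suc k) ≈ 1#

module Over {c ℓ : Level} (K : QAlgebra c ℓ) where
  open QAlgebra K
  open CommutativeRing scalars

  sumF : ∀ {n} → (Fin n → Carrier) → Carrier
  sumF {zero}    f = 0#
  sumF {ℕ.suc n} f = f Data.Fin.zero + sumF (λ j → f (Data.Fin.suc j))

  Δ : ∀ {n} → Adj n → (Fin n → Carrier) → Fin n → Carrier
  Δ a v i = v i - inv (degree a i) * sumF (λ j → if a i j then v j else 0#)

  Nonzero : ∀ {n} → (Fin n → Carrier) → Set ℓ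
  Nonzero u = ¬ (∀ i → u i ≈ 0#)

  IsEigenfunction : ∀ {n} → Adj n → Carrier → (Fin n → Carrier) → Set ℓ
  IsEigenfunction a λ′ u = Nonzero u × (∀ i → Δ a u i ≈ λ′ * u i)
    where open import Data.Product using (_×_)

-- Vertex set Fin (n₁ ℕ.+ m): the first n₁ vertices are Γ₁, the remaining m
-- are the vertices of Γ₂ other than p₂ (via punchIn p₂).

module Glue {n₁ m : ℕ} (G₁ : Graph n₁) (G₂ : Graph (ℕ.suc m))
            (p₁ : Fin n₁) (p₂ : Fin (ℕ.suc m)) where

  emb₁ : Fin n₁ → Fin (n₁ ℕ.+ m)
  emb₁ i = i ↑ˡ m

  emb₂ : Fin (ℕ.suc m) → Fin (n₁ ℕ.+ m)
  emb₂ j with p₂ ≟ j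
  ... | yes _  = emb₁ p₁
  ... | no p≢j = n₁ ↑ʳ punchOut p≢j

  gadj : Adj (n₁ ℕ.+ m)
  gadj x y with splitAt n₁ x | splitAt n₁ y
  ... | inj₁ i | inj₁ i′ = adj G₁ i i′
  ... | inj₁ i | inj₂ k  = ⌊ i ≟ p₁ ⌋ ∧ adj G₂ p₂ (punchIn p₂ k)
  ... | inj₂ k | inj₁ i  = ⌊ i ≟ p₁ ⌋ ∧ adj G₂ (punchIn p₂ k) p₂
  ... | inj₂ k | inj₂ k′ = adj G₂ (punchIn p₂ k) (punchIn p₂ k′)

-- Gluing at a common zero p of the two eigenfunctions changes the Laplacian
-- only at p: every other vertex keeps its neighbourhood, hence its degree and
-- neighbour sum.  At p the glued function vanishes, and the glued neighbour sum
-- is the sum of the two old neighbour sums; each of these is zero, because at a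
-- zero of an eigenfunction the eigenvalue equation reads -(1/n_p) Σ_{j∼p} f(j) = 0.
module Submission where

open import Defs hiding (sym)
open import Data.Nat using (ℕ; suc)
open import Data.Fin using (Fin)
open import Data.Product using (Σ; _×_)
open import Algebra.Bundles using (CommutativeRing)

open import Data.Nat as ℕ using (zero)
open import Data.Nat.Properties using (+-0-commutativeMonoid)
open import Data.Fin using (_↑ˡ_; _↑ʳ_; splitAt; join; punchIn; _≟_) renaming (zero to fzero; suc to fsuc)
open import Data.Fin.Properties
  using (splitAt-↑ˡ; splitAt-↑ʳ; join-splitAt; punchInᵢ≢i; punchIn-punchOut; punchOut-punchIn; punchOut-cong)
open import Data.Bool using (Bool; true; false; if_then_else_; _∧_)
open import Data.Sum using ([_,_]; [_,_]′)
open import Data.Product using (_,_)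
open import Function using (_∘_)
open import Relation.Nullary using (yes; no; contradiction)
open import Relation.Nullary.Decidable using (⌊_⌋; isYes≗does; dec-true; dec-false)
import Relation.Binary.PropositionalEquality as ≡
open ≡ using (_≡_; _≢_; cong)
open import Algebra.Bundles using (CommutativeMonoid)

isYes-≟-refl : ∀ {n} (i : Fin n) → ⌊ i ≟ i ⌋ ≡ true
isYes-≟-refl i = ≡.trans (isYes≗does (i ≟ i)) (dec-true (i ≟ i) ≡.refl)

isYes-≟-≢ : ∀ {n} {i j : Fin n} → i ≢ j → ⌊ i ≟ j ⌋ ≡ false
isYes-≟-≢ {i = i} {j} i≢j = ≡.trans (isYes≗does (i ≟ j)) (dec-false (i ≟ j) i≢j)

fin-+-elim : ∀ {p} {m n : ℕ} (P : Fin (m ℕ.+ n) → Set p) →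
             (∀ i → P (i ↑ˡ n)) → (∀ k → P (m ↑ʳ k)) → ∀ x → P x
fin-+-elim {m = m} {n} P left right x =
  ≡.subst P (join-splitAt m n x) ([_,_] {C = P ∘ join m n} left right (splitAt m x))

module SumWhere {a ℓ} (M : CommutativeMonoid a ℓ) where
  open CommutativeMonoid M
  open import Algebra.Properties.CommutativeMonoid.Sum M using (sum) public
  open import Algebra.Properties.CommutativeMonoid.Sum M
    using (sum-cong-≋; sum-remove; sum-replicate-zero)
  open import Relation.Binary.Reasoning.Setoid setoid

  sum-↑ : ∀ m {n} (f : Fin (m ℕ.+ n) → Carrier) →
          sum f ≈ sum (f ∘ (_↑ˡ n)) ∙ sum (f ∘ (m ↑ʳ_))
  sum-↑ zero    f = sym (identityˡ _)
  sum-↑ (suc m) f = trans (∙-congˡ (sum-↑ m (f ∘ fsuc))) (sym (assoc _ _ _))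

  sumWhere : ∀ {n} → (Fin n → Bool) → (Fin n → Carrier) → Carrier
  sumWhere r v = sum (λ j → if r j then v j else ε)

  if-cong : ∀ {b c : Bool} {x y : Carrier} → b ≡ c → x ≈ y →
            (if b then x else ε) ≈ (if c then y else ε)
  if-cong {true}  ≡.refl x≈y = x≈y
  if-cong {false} ≡.refl x≈y = refl

  sumWhere-cong : ∀ {n} {r s : Fin n → Bool} {v w : Fin n → Carrier} →
                  (∀ j → r j ≡ s j) → (∀ j → v j ≈ w j) → sumWhere r v ≈ sumWhere s w
  sumWhere-cong r≗s v≈w = sum-cong-≋ (λ j → if-cong (r≗s j) (v≈w j))

  sumWhere-congʳ : ∀ {n} (r : Fin n → Bool) {v w : Fin n → Carrier} →
                   (∀ j → v j ≈ w j) → sumWhere r v ≈ sumWhere r w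
  sumWhere-congʳ r = sumWhere-cong (λ _ → ≡.refl)

  sumWhere-none : ∀ {n} {r : Fin n → Bool} (v : Fin n → Carrier) →
                  (∀ j → r j ≡ false) → sumWhere r v ≈ ε
  sumWhere-none {n} v r≗false =
    trans (sumWhere-cong r≗false (λ _ → refl)) (sum-replicate-zero n)

  sumWhere-↑ : ∀ m {n} (r : Fin (m ℕ.+ n) → Bool) (v : Fin (m ℕ.+ n) → Carrier) →
               sumWhere r v ≈ sumWhere (r ∘ (_↑ˡ n)) (v ∘ (_↑ˡ n))
                            ∙ sumWhere (r ∘ (m ↑ʳ_)) (v ∘ (m ↑ʳ_))
  sumWhere-↑ m r v = sum-↑ m _

  sumWhere-removeAt : ∀ {n} (q : Fin (suc n)) (r : Fin (suc n) → Bool) (v : Fin (suc n) → Carrier) →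
                      sumWhere r v ≈ (if r q then v q else ε)
                                   ∙ sumWhere (r ∘ punchIn q) (v ∘ punchIn q)
  sumWhere-removeAt q r v = sum-remove {i = q} (λ j → if r j then v j else ε)

  sumWhere-only : ∀ {n} (q : Fin n) (r : Fin n → Bool) (v : Fin n → Carrier) →
                  (∀ j → j ≢ q → r j ≡ false) → sumWhere r v ≈ (if r q then v q else ε)
  sumWhere-only {suc n} q r v r≗false = begin
    sumWhere r v                                                   ≈⟨ sumWhere-removeAt q r v ⟩
    (if r q then v q else ε) ∙ sumWhere (r ∘ punchIn q) (v ∘ punchIn q)
      ≈⟨ ∙-congˡ (sumWhere-none _ (λ j → r≗false (punchIn q j) (punchInᵢ≢i q j))) ⟩
    (if r q then v q else ε) ∙ ε                                   ≈⟨ identityʳ _ ⟩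
    (if r q then v q else ε)                                       ∎

module ℕSum = SumWhere +-0-commutativeMonoid

count-sumWhere : ∀ {n} (r : Fin n → Bool) → count r ≡ ℕSum.sumWhere r (λ _ → 1)
count-sumWhere {zero}  r = ≡.refl
count-sumWhere {suc n} r = cong ((if r fzero then 1 else 0) ℕ.+_) (count-sumWhere (r ∘ fsuc))

module GlueProperties {n₁ m : ℕ} (Γ₁ : Graph n₁) (Γ₂ : Graph (suc m))
                      (p₁ : Fin n₁) (p₂ : Fin (suc m)) where
  open Glue Γ₁ Γ₂ p₁ p₂

  gadj-↑ˡ-↑ˡ : ∀ i i′ → gadj (i ↑ˡ m) (i′ ↑ˡ m) ≡ adj Γ₁ i i′
  gadj-↑ˡ-↑ˡ i i′ rewrite splitAt-↑ˡ n₁ i m | splitAt-↑ˡ n₁ i′ m = ≡.refl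

  gadj-↑ˡ-↑ʳ : ∀ i k → gadj (i ↑ˡ m) (n₁ ↑ʳ k) ≡ ⌊ i ≟ p₁ ⌋ ∧ adj Γ₂ p₂ (punchIn p₂ k)
  gadj-↑ˡ-↑ʳ i k rewrite splitAt-↑ˡ n₁ i m | splitAt-↑ʳ n₁ m k = ≡.refl

  gadj-↑ʳ-↑ˡ : ∀ k i → gadj (n₁ ↑ʳ k) (i ↑ˡ m) ≡ ⌊ i ≟ p₁ ⌋ ∧ adj Γ₂ (punchIn p₂ k) p₂
  gadj-↑ʳ-↑ˡ k i rewrite splitAt-↑ʳ n₁ m k | splitAt-↑ˡ n₁ i m = ≡.refl

  gadj-↑ʳ-↑ʳ : ∀ k k′ → gadj (n₁ ↑ʳ k) (n₁ ↑ʳ k′) ≡ adj Γ₂ (punchIn p₂ k) (punchIn p₂ k′)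
  gadj-↑ʳ-↑ʳ k k′ rewrite splitAt-↑ʳ n₁ m k | splitAt-↑ʳ n₁ m k′ = ≡.refl

  emb₂-p₂ : emb₂ p₂ ≡ emb₁ p₁
  emb₂-p₂ with p₂ ≟ p₂
  ... | yes _ = ≡.refl
  ... | no p₂≢p₂ = contradiction ≡.refl p₂≢p₂

  emb₂-punchIn : ∀ k → emb₂ (punchIn p₂ k) ≡ n₁ ↑ʳ k
  emb₂-punchIn k with p₂ ≟ punchIn p₂ k
  ... | yes p₂≡ = contradiction (≡.sym p₂≡) (punchInᵢ≢i p₂ k)
  ... | no _    = cong (n₁ ↑ʳ_) (≡.trans (punchOut-cong p₂ ≡.refl) (punchOut-punchIn p₂))

  module Rows {a ℓ} (M : CommutativeMonoid a ℓ) where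
    open CommutativeMonoid M
    open SumWhere M
    open import Relation.Binary.Reasoning.Setoid setoid

    sumWhere-gadj-emb₁ : ∀ {i} → i ≢ p₁ → (g : Fin (n₁ ℕ.+ m) → Carrier) →
                       sumWhere (gadj (emb₁ i)) g ≈ sumWhere (adj Γ₁ i) (g ∘ emb₁)
    sumWhere-gadj-emb₁ {i} i≢p₁ g = begin
      sumWhere (gadj (emb₁ i)) g                                     ≈⟨ sumWhere-↑ n₁ _ g ⟩
      sumWhere (gadj (emb₁ i) ∘ (_↑ˡ m)) (g ∘ emb₁)
        ∙ sumWhere (gadj (emb₁ i) ∘ (n₁ ↑ʳ_)) (g ∘ (n₁ ↑ʳ_))
        ≈⟨ ∙-cong (sumWhere-cong (gadj-↑ˡ-↑ˡ i) (λ _ → refl))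
                  (sumWhere-none _ (λ k → ≡.trans (gadj-↑ˡ-↑ʳ i k) (cong (_∧ _) (isYes-≟-≢ i≢p₁)))) ⟩
      sumWhere (adj Γ₁ i) (g ∘ emb₁) ∙ ε                              ≈⟨ identityʳ _ ⟩
      sumWhere (adj Γ₁ i) (g ∘ emb₁)                                  ∎

    sumWhere-gadj-↑ʳ : ∀ k (g : Fin (n₁ ℕ.+ m) → Carrier) →
                       sumWhere (gadj (n₁ ↑ʳ k)) g ≈ sumWhere (adj Γ₂ (punchIn p₂ k)) (g ∘ emb₂)
    sumWhere-gadj-↑ʳ k g = begin
      sumWhere (gadj x) g                                            ≈⟨ sumWhere-↑ n₁ _ g ⟩
      sumWhere (gadj x ∘ (_↑ˡ m)) (g ∘ emb₁) ∙ sumWhere (gadj x ∘ (n₁ ↑ʳ_)) (g ∘ (n₁ ↑ʳ_))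
        ≈⟨ ∙-cong Γ₁-part (sumWhere-cong (gadj-↑ʳ-↑ʳ k) (λ k′ → reflexive (cong g (≡.sym (emb₂-punchIn k′))))) ⟩
      (if r p₂ then g (emb₂ p₂) else ε) ∙ sumWhere (r ∘ punchIn p₂) (g ∘ emb₂ ∘ punchIn p₂)
        ≈⟨ sym (sumWhere-removeAt p₂ r (g ∘ emb₂)) ⟩
      sumWhere r (g ∘ emb₂)                                          ∎
      where
      x = n₁ ↑ʳ k
      r = adj Γ₂ (punchIn p₂ k)
      Γ₁-part : sumWhere (gadj x ∘ (_↑ˡ m)) (g ∘ emb₁) ≈ (if r p₂ then g (emb₂ p₂) else ε)
      Γ₁-part = trans
        (sumWhere-only p₁ _ _ (λ i i≢p₁ → ≡.trans (gadj-↑ʳ-↑ˡ k i) (cong (_∧ _) (isYes-≟-≢ i≢p₁))))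
        (if-cong (≡.trans (gadj-↑ʳ-↑ˡ k p₁) (cong (_∧ _) (isYes-≟-refl p₁)))
                 (reflexive (cong g (≡.sym emb₂-p₂))))

    sumWhere-gadj-p₁ : (g : Fin (n₁ ℕ.+ m) → Carrier) →
                       sumWhere (gadj (emb₁ p₁)) g
                         ≈ sumWhere (adj Γ₁ p₁) (g ∘ emb₁) ∙ sumWhere (adj Γ₂ p₂) (g ∘ emb₂)
    sumWhere-gadj-p₁ g = begin
      sumWhere (gadj x) g                                            ≈⟨ sumWhere-↑ n₁ _ g ⟩
      sumWhere (gadj x ∘ (_↑ˡ m)) (g ∘ emb₁) ∙ sumWhere (gadj x ∘ (n₁ ↑ʳ_)) (g ∘ (n₁ ↑ʳ_))
        ≈⟨ ∙-cong (sumWhere-cong (gadj-↑ˡ-↑ˡ p₁) (λ _ → refl)) Γ₂-part ⟩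
      sumWhere (adj Γ₁ p₁) (g ∘ emb₁) ∙ sumWhere (adj Γ₂ p₂) (g ∘ emb₂) ∎
      where
      x = emb₁ p₁
      r = adj Γ₂ p₂
      Γ₂-part : sumWhere (gadj x ∘ (n₁ ↑ʳ_)) (g ∘ (n₁ ↑ʳ_)) ≈ sumWhere r (g ∘ emb₂)
      Γ₂-part = begin
        sumWhere (gadj x ∘ (n₁ ↑ʳ_)) (g ∘ (n₁ ↑ʳ_))
          ≈⟨ sumWhere-cong (λ k → ≡.trans (gadj-↑ˡ-↑ʳ p₁ k) (cong (_∧ _) (isYes-≟-refl p₁)))
                           (λ k → reflexive (cong g (≡.sym (emb₂-punchIn k)))) ⟩
        sumWhere (r ∘ punchIn p₂) (g ∘ emb₂ ∘ punchIn p₂)           ≈⟨ identityˡ _ ⟨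
        ε ∙ sumWhere (r ∘ punchIn p₂) (g ∘ emb₂ ∘ punchIn p₂)
          ≈⟨ ∙-congʳ (if-cong (≡.sym (irrefl Γ₂ p₂)) refl) ⟩
        (if r p₂ then g (emb₂ p₂) else ε) ∙ sumWhere (r ∘ punchIn p₂) (g ∘ emb₂ ∘ punchIn p₂)
          ≈⟨ sumWhere-removeAt p₂ r (g ∘ emb₂) ⟨
        sumWhere r (g ∘ emb₂)                                        ∎

  open Rows +-0-commutativeMonoid

  degree-gadj-emb₁ : ∀ {i} → i ≢ p₁ → degree gadj (emb₁ i) ≡ degree (adj Γ₁) i
  degree-gadj-emb₁ {i} i≢p₁ = ≡.trans (count-sumWhere (gadj (emb₁ i)))
    (≡.trans (sumWhere-gadj-emb₁ i≢p₁ (λ _ → 1)) (≡.sym (count-sumWhere (adj Γ₁ i))))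

  degree-gadj-↑ʳ : ∀ k → degree gadj (n₁ ↑ʳ k) ≡ degree (adj Γ₂) (punchIn p₂ k)
  degree-gadj-↑ʳ k = ≡.trans (count-sumWhere (gadj (n₁ ↑ʳ k)))
    (≡.trans (sumWhere-gadj-↑ʳ k (λ _ → 1)) (≡.sym (count-sumWhere (adj Γ₂ (punchIn p₂ k)))))

module Laplacian {c ℓ} (K : QAlgebra c ℓ) where
  open QAlgebra K
  open CommutativeRing scalars
  open import Algebra.Properties.Ring ring using (x∙y⁻¹≈ε⇒x≈y; x≈y⇒x∙y⁻¹≈ε)
  open Over K
  open SumWhere +-commutativeMonoid using (sumWhere)
  open import Relation.Binary.Reasoning.Setoid setoid

  Δ-sumWhere : ∀ {n} (a : Adj n) (v : Fin n → Carrier) i →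
               Δ a v i ≡ v i - inv (degree a i) * sumWhere (a i) v
  Δ-sumWhere a v i = cong (λ s → v i - inv (degree a i) * s) (sumF≡sum (λ j → if a i j then v j else 0#))
    where
    sumF≡sum : ∀ {n} (f : Fin n → Carrier) → sumF f ≡ SumWhere.sum +-commutativeMonoid f
    sumF≡sum {zero}  f = ≡.refl
    sumF≡sum {suc n} f = cong (f fzero +_) (sumF≡sum (f ∘ fsuc))

  Δ-cong : ∀ {n n′} (a : Adj n) (b : Adj n′) {v w i j} →
           v i ≈ w j → degree a i ≡ degree b j → sumWhere (a i) v ≈ sumWhere (b j) w →
           Δ a v i ≈ Δ b w j
  Δ-cong a b {v} {w} {i} {j} vᵢ≈wⱼ deg≡ sum≈ = begin
    Δ a v i                                     ≡⟨ Δ-sumWhere a v i ⟩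
    v i - inv (degree a i) * sumWhere (a i) v
      ≈⟨ +-cong vᵢ≈wⱼ (-‿cong (*-cong (reflexive (cong inv deg≡)) sum≈)) ⟩
    w j - inv (degree b j) * sumWhere (b j) w   ≡⟨ Δ-sumWhere b w j ⟨
    Δ b w j                                     ∎

  Δ-zero : ∀ {n} (a : Adj n) (v : Fin n → Carrier) i →
           v i ≈ 0# → sumWhere (a i) v ≈ 0# → Δ a v i ≈ 0#
  Δ-zero a v i vᵢ≈0 sum≈0 = begin
    Δ a v i                                    ≡⟨ Δ-sumWhere a v i ⟩
    v i - inv (degree a i) * sumWhere (a i) v
      ≈⟨ x≈y⇒x∙y⁻¹≈ε (trans vᵢ≈0 (sym (trans (*-congˡ sum≈0) (zeroʳ _)))) ⟩
    0#                                         ∎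

  inv-cancel : ∀ k {x} → inv (suc k) * x ≈ 0# → x ≈ 0#
  inv-cancel k {x} inv*x≈0 = begin
    x                                     ≈⟨ *-identityˡ x ⟨
    1# * x                                ≈⟨ *-congʳ (inv-suc k) ⟨
    natR scalars (suc k) * inv (suc k) * x ≈⟨ *-assoc _ _ _ ⟩
    natR scalars (suc k) * (inv (suc k) * x) ≈⟨ *-congˡ inv*x≈0 ⟩
    natR scalars (suc k) * 0#             ≈⟨ zeroʳ _ ⟩
    0#                                    ∎

  eigenfunction-zero⇒sumWhere-zero :
    ∀ {n} (a : Adj n) {lam} {v : Fin n → Carrier} i →
    degree a i ≢ 0 → v i ≈ 0# → Δ a v i ≈ lam * v i → sumWhere (a i) v ≈ 0#
  eigenfunction-zero⇒sumWhere-zero a {lam} {v} i deg≢0 vᵢ≈0 Δv≈lamv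
    with degree a i | Δ-sumWhere a v i
  ... | zero  | _  = contradiction ≡.refl deg≢0
  ... | suc k | Δ≡ = inv-cancel k (trans (sym inv*sum≈vᵢ) vᵢ≈0)
    where
    inv*sum≈vᵢ : v i ≈ inv (suc k) * sumWhere (a i) v
    inv*sum≈vᵢ = x∙y⁻¹≈ε⇒x≈y _ _
      (trans (reflexive (≡.sym Δ≡)) (trans Δv≈lamv (trans (*-congˡ vᵢ≈0) (zeroʳ lam))))

module EigenGluing {c ℓ} (K : QAlgebra c ℓ) {n₁ m : ℕ} (Γ₁ : Graph n₁) (Γ₂ : Graph (suc m))
                   (p₁ : Fin n₁) (p₂ : Fin (suc m)) where
  open QAlgebra K
  open CommutativeRing scalars
  open Over K
  open Laplacian K
  open Glue Γ₁ Γ₂ p₁ p₂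
  open GlueProperties Γ₁ Γ₂ p₁ p₂
  open Rows +-commutativeMonoid
  open SumWhere +-commutativeMonoid using (sumWhere; sumWhere-congʳ)
  open import Relation.Binary.Reasoning.Setoid setoid

  glue : (Fin n₁ → Carrier) → (Fin (suc m) → Carrier) → Fin (n₁ ℕ.+ m) → Carrier
  glue f₁ f₂ x = [ f₁ , f₂ ∘ punchIn p₂ ]′ (splitAt n₁ x)

  module _ (f₁ : Fin n₁ → Carrier) (f₂ : Fin (suc m) → Carrier) where

    glue-emb₁ : ∀ i → glue f₁ f₂ (emb₁ i) ≡ f₁ i
    glue-emb₁ i = cong [ f₁ , f₂ ∘ punchIn p₂ ]′ (splitAt-↑ˡ n₁ i m)

    glue-↑ʳ : ∀ k → glue f₁ f₂ (n₁ ↑ʳ k) ≡ f₂ (punchIn p₂ k)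
    glue-↑ʳ k = cong [ f₁ , f₂ ∘ punchIn p₂ ]′ (splitAt-↑ʳ n₁ m k)

    glue-emb₂ : f₁ p₁ ≈ f₂ p₂ → ∀ j → glue f₁ f₂ (emb₂ j) ≈ f₂ j
    glue-emb₂ f₁p₁≈f₂p₂ j with p₂ ≟ j
    ... | yes ≡.refl = trans (reflexive (glue-emb₁ p₁)) f₁p₁≈f₂p₂
    ... | no p₂≢j    = reflexive (≡.trans (glue-↑ʳ _) (cong f₂ (punchIn-punchOut p₂≢j)))

  module _ {lam : Carrier} {f₁ : Fin n₁ → Carrier} {f₂ : Fin (suc m) → Carrier}
           (Γ₁-noIsolated : NoIsolated Γ₁) (Γ₂-noIsolated : NoIsolated Γ₂)
           (f₁-nonzero : Nonzero f₁)
           (Δf₁ : ∀ i → Δ (adj Γ₁) f₁ i ≈ lam * f₁ i) (Δf₂ : ∀ j → Δ (adj Γ₂) f₂ j ≈ lam * f₂ j)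
           (f₁p₁≈0 : f₁ p₁ ≈ 0#) (f₂p₂≈0 : f₂ p₂ ≈ 0#) where

    private
      u = glue f₁ f₂

      u∘emb₂≈f₂ : ∀ j → u (emb₂ j) ≈ f₂ j
      u∘emb₂≈f₂ = glue-emb₂ f₁ f₂ (trans f₁p₁≈0 (sym f₂p₂≈0))

      Δu-emb₁ : ∀ i → Δ gadj u (emb₁ i) ≈ lam * u (emb₁ i)
      Δu-emb₁ i with i ≟ p₁
      ... | no i≢p₁ = begin
        Δ gadj u (emb₁ i)      ≈⟨ Δ-cong gadj (adj Γ₁) (reflexive (glue-emb₁ f₁ f₂ i)) (degree-gadj-emb₁ i≢p₁)
                                    (trans (sumWhere-gadj-emb₁ i≢p₁ u)
                                           (sumWhere-congʳ (adj Γ₁ i) (reflexive ∘ glue-emb₁ f₁ f₂))) ⟩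
        Δ (adj Γ₁) f₁ i        ≈⟨ Δf₁ i ⟩
        lam * f₁ i             ≡⟨ cong (lam *_) (glue-emb₁ f₁ f₂ i) ⟨
        lam * u (emb₁ i)       ∎
      ... | yes ≡.refl = trans (Δ-zero gadj u (emb₁ p₁) up≈0 neighbours≈0)
                               (sym (trans (*-congˡ up≈0) (zeroʳ lam)))
        where
        up≈0 : u (emb₁ p₁) ≈ 0#
        up≈0 = trans (reflexive (glue-emb₁ f₁ f₂ p₁)) f₁p₁≈0
        neighbours₁≈0 : sumWhere (adj Γ₁ p₁) (u ∘ emb₁) ≈ 0#
        neighbours₁≈0 = trans (sumWhere-congʳ (adj Γ₁ p₁) (reflexive ∘ glue-emb₁ f₁ f₂))
          (eigenfunction-zero⇒sumWhere-zero (adj Γ₁) {v = f₁} p₁ (Γ₁-noIsolated p₁) f₁p₁≈0 (Δf₁ p₁))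
        neighbours₂≈0 : sumWhere (adj Γ₂ p₂) (u ∘ emb₂) ≈ 0#
        neighbours₂≈0 = trans (sumWhere-congʳ (adj Γ₂ p₂) u∘emb₂≈f₂)
          (eigenfunction-zero⇒sumWhere-zero (adj Γ₂) {v = f₂} p₂ (Γ₂-noIsolated p₂) f₂p₂≈0 (Δf₂ p₂))
        neighbours≈0 : sumWhere (gadj (emb₁ p₁)) u ≈ 0#
        neighbours≈0 = trans (sumWhere-gadj-p₁ u)
          (trans (+-cong neighbours₁≈0 neighbours₂≈0) (+-identityʳ 0#))

      Δu-↑ʳ : ∀ k → Δ gadj u (n₁ ↑ʳ k) ≈ lam * u (n₁ ↑ʳ k)
      Δu-↑ʳ k = begin
        Δ gadj u (n₁ ↑ʳ k)          ≈⟨ Δ-cong gadj (adj Γ₂) {w = f₂} (reflexive (glue-↑ʳ f₁ f₂ k)) (degree-gadj-↑ʳ k)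
                                          (trans (sumWhere-gadj-↑ʳ k u)
                                                 (sumWhere-congʳ (adj Γ₂ (punchIn p₂ k)) u∘emb₂≈f₂)) ⟩
        Δ (adj Γ₂) f₂ (punchIn p₂ k) ≈⟨ Δf₂ (punchIn p₂ k) ⟩
        lam * f₂ (punchIn p₂ k)     ≡⟨ cong (lam *_) (glue-↑ʳ f₁ f₂ k) ⟨
        lam * u (n₁ ↑ʳ k)           ∎

    glue-isEigenfunction : IsEigenfunction gadj lam (glue f₁ f₂)
    glue-isEigenfunction =
      (λ u≈0 → f₁-nonzero (λ i → trans (reflexive (≡.sym (glue-emb₁ f₁ f₂ i))) (u≈0 (emb₁ i)))) ,
      fin-+-elim (λ x → Δ gadj u x ≈ lam * u x) Δu-emb₁ Δu-↑ʳ

mainTheorem7 :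
    ∀ {c ℓ} (K : QAlgebra c ℓ) →
    let open QAlgebra K
        open CommutativeRing scalars
        open Over K
    in
    ∀ {n₁ m : ℕ} (Γ₁ : Graph n₁) (Γ₂ : Graph (suc m)) →
    Connected Γ₁ → Connected Γ₂ → NoIsolated Γ₁ → NoIsolated Γ₂ →
    (lam : Carrier) (f₁ : Fin n₁ → Carrier) (f₂ : Fin (suc m) → Carrier) →
    IsEigenfunction (adj Γ₁) lam f₁ → IsEigenfunction (adj Γ₂) lam f₂ →
    (p₁ : Fin n₁) (p₂ : Fin (suc m)) → f₁ p₁ ≈ 0# → f₂ p₂ ≈ 0# →
    let open Glue Γ₁ Γ₂ p₁ p₂ in
    Σ (Fin (n₁ Data.Nat.+ m) → Carrier) λ u →
      IsEigenfunction gadj lam u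
      × (∀ i → u (emb₁ i) ≈ f₁ i)
      × (∀ j → u (emb₂ j) ≈ f₂ j)
mainTheorem7 K Γ₁ Γ₂ _ _ Γ₁-noIsolated Γ₂-noIsolated lam f₁ f₂ (f₁-nonzero , Δf₁) (_ , Δf₂)
             p₁ p₂ f₁p₁≈0 f₂p₂≈0 =
  glue f₁ f₂ ,
  glue-isEigenfunction Γ₁-noIsolated Γ₂-noIsolated f₁-nonzero Δf₁ Δf₂ f₁p₁≈0 f₂p₂≈0 ,
  (λ i → reflexive (glue-emb₁ f₁ f₂ i)) ,
  glue-emb₂ f₁ f₂ (trans f₁p₁≈0 (sym f₂p₂≈0))
  where
  open EigenGluing K Γ₁ Γ₂ p₁ p₂
  open CommutativeRing (QAlgebra.scalars K) using (reflexive; trans; sym)
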